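{- For every finite string $W$ in the letters $A,B,X$, one has $|(AXAW)|=2t|[W]|+|[XAWA]|$ in the tight puzzle, where $(AXAW)$ is the cyclic sentence of the string $AXAW$.
   Context: Tight puzzle: words with (coefficient, weight) $X$ $(1,0)$; $XA$ $(1,1)$; $XAA$ $(1,1)$; $AXA$ $(2,1)$; $AAA$ $(-1,1)$; $BA$ $(-1,1)$; $ABA$ $(-1,1)$; $XXA$ $(-1,1)$. A parsing is a decomposition of a string into consecutive words from this list, in which the word $X$ is never immediately followed by the word $XA$ nor by the word $BA$. A cyclic sentence $(U)$ is the string $U$ up to cyclic permutation, parsed cyclically. For a finite string $U$, the locked string $[U]$ has as parsings only the decompositions of the finite string $U$ itself into words (no padding). Coefficient of a parsing = product of coefficients of its words, weight = sum of weights; $c(S,w)$ = sum of coefficients of weight-$w$ parsings; $|S|=\sum_{w\ge0}c(S,w)t^w$. -}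

module Defs where

open import Data.Bool using (Bool; true; false; _∧_; not; if_then_else_)
open import Data.Nat using (ℕ; zero; suc; _∸_; _<ᵇ_; _≡ᵇ_)
open import Data.Integer using (ℤ; +_; _*_; _+_)
open import Data.List using (List; []; _∷_; _++_; concatMap; map; length; drop; take; filterᵇ; foldr; applyUpTo)
open import Relation.Binary.PropositionalEquality using (_≡_)
open import Data.Product using (_×_; _,_; proj₁; proj₂)

data Letter : Set where
  A B X : Letter

data Word : Set where
  wX wXA wXAA wAXA wAAA wBA wABA wXXA : Word

allWords : List Word
allWords = wX ∷ wXA ∷ wXAA ∷ wAXA ∷ wAAA ∷ wBA ∷ wABA ∷ wXXA ∷ []

spell : Word → List Letter
spell wX   = X ∷ []
spell wXA  = X ∷ A ∷ []
spell wXAA = X ∷ A ∷ A ∷ []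
spell wAXA = A ∷ X ∷ A ∷ []
spell wAAA = A ∷ A ∷ A ∷ []
spell wBA  = B ∷ A ∷ []
spell wABA = A ∷ B ∷ A ∷ []
spell wXXA = X ∷ X ∷ A ∷ []

coef : Word → ℤ
coef wX   = + 1
coef wXA  = + 1
coef wXAA = + 1
coef wAXA = + 2
coef wAAA = Data.Integer.-[1+ 0 ]
coef wBA  = Data.Integer.-[1+ 0 ]
coef wABA = Data.Integer.-[1+ 0 ]
coef wXXA = Data.Integer.-[1+ 0 ]

weight : Word → ℕ
weight wX = 0
weight _  = 1

allowed : Word → Word → Bool
allowed wX wXA = false
allowed wX wBA = false
allowed _  _   = true

_==L_ : Letter → Letter → Bool
A ==L A = true
B ==L B = true
X ==L X = true
_ ==L _ = false

_==S_ : List Letter → List Letter → Bool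
[]       ==S []       = true
(a ∷ u)  ==S (b ∷ v)  = (a ==L b) ∧ (u ==S v)
_        ==S _        = false

spellAll : List Word → List Letter
spellAll ws = foldr (λ w s → spell w ++ s) [] ws

validLin : List Word → Bool
validLin []            = true
validLin (w ∷ [])      = true
validLin (w ∷ v ∷ ws)  = allowed w v ∧ validLin (v ∷ ws)

listsUpTo : ℕ → List (List Word)
listsUpTo zero    = [] ∷ []
listsUpTo (suc k) = [] ∷ concatMap (λ w → map (w ∷_) (listsUpTo k)) allWords

-- Parsings of the locked string [U]: decompositions of U itself into words
-- respecting the adjacency rule.  (Every word has length ≥ 1, so a
-- decomposition of U uses at most length U words.)
lockedParsings : List Letter → List (List Word)
lockedParsings U =
  filterᵇ (λ ws → (spellAll ws ==S U) ∧ validLin ws) (listsUpTo (length U))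

firstLen : List Word → ℕ
firstLen []      = 0
firstLen (w ∷ _) = length (spell w)

lastW : Word → List Word → Word
lastW w []       = w
lastW _ (v ∷ vs) = lastW v vs

wrapOK : List Word → Bool
wrapOK []       = true
wrapOK (w ∷ ws) = allowed (lastW w ws) w

rotR : ℕ → List Letter → List Letter
rotR j U = drop (length U ∸ j) U ++ take (length U ∸ j) U

-- A cyclic parsing is a set of cut
-- points on the cycle of positions 0..n-1 of U such that the arcs spell
-- words and cyclically consecutive words respect the adjacency rule.
-- It is encoded (bijectively) by (j , ws) where the word covering position 0
-- starts j positions before it (0 ≤ j < n, j < its length) and ws is the
-- list of words read from that start, i.e. a decomposition of rotR j U.
cyclicParsings : List Letter → List (ℕ × List Word)
cyclicParsings U =
  concatMap
    (λ j → map (j ,_)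
      (filterᵇ (λ ws → (j <ᵇ firstLen ws) ∧ wrapOK ws)
        (lockedParsings (rotR j U))))
    (applyUpTo (λ j → j) (length U))

coefP : List Word → ℤ
coefP ws = foldr (λ w c → coef w * c) (+ 1) ws

weightP : List Word → ℕ
weightP ws = foldr (λ w n → weight w Data.Nat.+ n) 0 ws

sumℤ : List ℤ → ℤ
sumℤ = foldr _+_ (+ 0)

-- A polynomial in t with integer coefficients, given by its coefficient
-- sequence (finitely supported here).
Poly : Set
Poly = ℕ → ℤ

locked∣_∣ : List Letter → Poly
locked∣ U ∣ w = sumℤ (map coefP (filterᵇ (λ ws → weightP ws ≡ᵇ w) (lockedParsings U)))

cyclic∣_∣ : List Letter → Poly
cyclic∣ U ∣ w =
  sumℤ (map (λ p → coefP (proj₂ p))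
    (filterᵇ (λ p → weightP (proj₂ p) ≡ᵇ w) (cyclicParsings U)))

_+P_ : Poly → Poly → Poly
(f +P g) w = f w + g w

_·t_ : ℤ → Poly → Poly
(c ·t f) zero    = + 0
(c ·t f) (suc w) = c * f w

_≈P_ : Poly → Poly → Set
f ≈P g = ∀ w → f w ≡ g w

module Submission where

-- Both polynomials are finite sums of signed weighted terms, one for every
-- candidate list of words.
--
-- Write U = AXAW and T = XAWA.  Words have length at most three, so only the
-- offsets j = 0, 1, 2 contribute.
--  * j = 0: the only word that reads AXA… from the first letter is AXA
--    (coefficient 2, weight 1), and it may be preceded and followed by any
--    word; removing it leaves a parsing of [W].  This gives 2t|[W]|.
--  * j = 1, 2: moving the first word v to the end turns a cyclic parsing at
--    offset j with |v| = j + 1 into a parsing of [T] ending in v (T is U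
--    rotated left by one letter).  Conversely the last word of a parsing of
--    [T] ends in A, so it is not X and has length 2 or 3; a word of length 3
--    cannot sit at offset 1 because its third letter would have to be X.
--    Together the offsets 1 and 2 therefore give |[T]|.

open import Defs
import Algebra.Properties.CommutativeSemigroup as CommSemigroupProps
open import Data.Bool using (Bool; true; false; _∧_; if_then_else_)
open import Data.Bool.Properties using (∧-assoc; ∧-identityʳ)
open import Data.Empty using (⊥-elim)
open import Data.Integer using (ℤ; +_; _+_; _*_)
import Data.Integer.Properties as ℤₚ
open import Data.List using (List; []; _∷_; _++_; map; concatMap; filterᵇ; applyUpTo; length; take; drop; foldr)
open import Data.List.Properties using (++-assoc; ++-identityʳ; ∷-injective; ∷ʳ-injective; length-++; length-++-comm; length-drop; take++drop≡id; map-∘)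
open import Data.Nat as ℕ using (ℕ; zero; suc; _∸_; _≤_; _<_; z≤n; s≤s; _<ᵇ_; _≡ᵇ_)
import Data.Nat.Properties as ℕₚ
open import Data.Product using (Σ; _×_; _,_; proj₁; proj₂)
open import Function using (case_of_)
open import Relation.Binary.PropositionalEquality
open ≡-Reasoning

open CommSemigroupProps ℤₚ.+-commutativeSemigroup using (interchange)

∑ : {I : Set} → List I → (I → ℤ) → ℤ
∑ L f = sumℤ (map f L)

when : Bool → ℤ → ℤ
when b x = if b then x else + 0

when-0 : ∀ b → when b (+ 0) ≡ + 0
when-0 true  = refl
when-0 false = refl

when-∧ : ∀ a b x → when (a ∧ b) x ≡ when a (when b x)
when-∧ true  b x = refl
when-∧ false b x = refl

when-* : ∀ b c x → when b (c * x) ≡ c * when b x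
when-* true  c x = refl
when-* false c x = sym (ℤₚ.*-zeroʳ c)

module _ {I : Set} where

  ∑-cong : (L : List I) {f g : I → ℤ} → (∀ x → f x ≡ g x) → ∑ L f ≡ ∑ L g
  ∑-cong []      f≗g = refl
  ∑-cong (x ∷ L) f≗g = cong₂ _+_ (f≗g x) (∑-cong L f≗g)

  ∑-zero : (L : List I) {f : I → ℤ} → (∀ x → f x ≡ + 0) → ∑ L f ≡ + 0
  ∑-zero []      f≗0 = refl
  ∑-zero (x ∷ L) f≗0 = cong₂ _+_ (f≗0 x) (∑-zero L f≗0)

  ∑-+ : (L : List I) (f g : I → ℤ) → ∑ L (λ x → f x + g x) ≡ ∑ L f + ∑ L g
  ∑-+ []      f g = refl
  ∑-+ (x ∷ L) f g = trans (cong (_+_ (f x + g x)) (∑-+ L f g)) (interchange (f x) (g x) _ _)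

  ∑-scale : (L : List I) (c : ℤ) (f : I → ℤ) → ∑ L (λ x → c * f x) ≡ c * ∑ L f
  ∑-scale []      c f = sym (ℤₚ.*-zeroʳ c)
  ∑-scale (x ∷ L) c f = trans (cong (_+_ (c * f x)) (∑-scale L c f)) (sym (ℤₚ.*-distribˡ-+ c (f x) _))

  ∑-++ : (L M : List I) (f : I → ℤ) → ∑ (L ++ M) f ≡ ∑ L f + ∑ M f
  ∑-++ []      M f = sym (ℤₚ.+-identityˡ _)
  ∑-++ (x ∷ L) M f = trans (cong (_+_ (f x)) (∑-++ L M f)) (sym (ℤₚ.+-assoc (f x) _ _))

  ∑-filter : (L : List I) (p : I → Bool) (f : I → ℤ) → ∑ (filterᵇ p L) f ≡ ∑ L (λ x → when (p x) (f x))
  ∑-filter []      p f = refl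
  ∑-filter (x ∷ L) p f with p x
  ... | true  = cong (_+_ (f x)) (∑-filter L p f)
  ... | false = trans (∑-filter L p f) (sym (ℤₚ.+-identityˡ _))

module _ {I J : Set} where

  ∑-map : (L : List J) (h : J → I) (f : I → ℤ) → ∑ (map h L) f ≡ ∑ L (λ x → f (h x))
  ∑-map L h f = cong sumℤ (sym (map-∘ L))

  ∑-concatMap : (L : List J) (F : J → List I) (f : I → ℤ) → ∑ (concatMap F L) f ≡ ∑ L (λ x → ∑ (F x) f)
  ∑-concatMap []      F f = refl
  ∑-concatMap (x ∷ L) F f = trans (∑-++ (F x) (concatMap F L) f) (cong (_+_ (∑ (F x) f)) (∑-concatMap L F f))

  ∑-swap : (L : List J) (M : List I) (F : J → I → ℤ) → ∑ L (λ x → ∑ M (F x)) ≡ ∑ M (λ y → ∑ L (λ x → F x y))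
  ∑-swap []      M F = sym (∑-zero M (λ _ → refl))
  ∑-swap (x ∷ L) M F = trans (cong (_+_ (∑ M (F x))) (∑-swap L M F)) (sym (∑-+ M (F x) _))

∑-applyUpTo-zero : ∀ (F : ℕ → ℤ) f n → (∀ j → F (f j) ≡ + 0) → ∑ (applyUpTo f n) F ≡ + 0
∑-applyUpTo-zero F f zero    F∘f≗0 = refl
∑-applyUpTo-zero F f (suc n) F∘f≗0 = cong₂ _+_ (F∘f≗0 0) (∑-applyUpTo-zero F (λ j → f (suc j)) n (λ j → F∘f≗0 (suc j)))

∑word : (Word → ℤ) → ℤ
∑word = ∑ allWords

∑upTo : ℕ → (List Word → ℤ) → ℤ
∑upTo k = ∑ (listsUpTo k)

∑upTo-cons : ∀ k g → ∑upTo (suc k) g ≡ g [] + ∑word (λ v → ∑upTo k (λ ws → g (v ∷ ws)))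
∑upTo-cons k g = cong (_+_ (g [])) (trans (∑-concatMap allWords (λ v → map (v ∷_) (listsUpTo k)) g)
                                       (∑-cong allWords (λ v → ∑-map (listsUpTo k) (v ∷_) g)))

∑upTo-snoc : ∀ k g → ∑upTo (suc k) g ≡ g [] + ∑word (λ v → ∑upTo k (λ ws → g (ws ++ v ∷ [])))
∑upTo-snoc zero    g = ∑upTo-cons zero g
∑upTo-snoc (suc k) g = begin
    ∑upTo (suc (suc k)) g
  ≡⟨ ∑upTo-cons (suc k) g ⟩
    g [] + ∑word (λ v → ∑upTo (suc k) (λ ws → g (v ∷ ws)))
  ≡⟨ cong (_+_ (g [])) (∑-cong allWords (λ v → ∑upTo-snoc k (λ ws → g (v ∷ ws)))) ⟩
    g [] + ∑word (λ v → g (v ∷ []) + ∑word (λ u → inner v u))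
  ≡⟨ cong (_+_ (g [])) (∑-+ allWords (λ v → g (v ∷ [])) (λ v → ∑word (inner v))) ⟩
    g [] + (∑word (λ v → g (v ∷ [])) + ∑word (λ v → ∑word (inner v)))
  ≡⟨ cong (λ s → g [] + (∑word (λ v → g (v ∷ [])) + s)) (∑-swap allWords allWords inner) ⟩
    g [] + (∑word (λ u → g (u ∷ [])) + ∑word (λ u → ∑word (λ v → inner v u)))
  ≡⟨ cong (_+_ (g [])) (sym (∑-+ allWords (λ u → g (u ∷ [])) (λ u → ∑word (λ v → inner v u)))) ⟩
    g [] + ∑word (λ u → g (u ∷ []) + ∑word (λ v → inner v u))
  ≡⟨ cong (_+_ (g [])) (∑-cong allWords (λ u → sym (∑upTo-cons k (λ ws → g (ws ++ u ∷ []))))) ⟩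
    g [] + ∑word (λ u → ∑upTo (suc k) (λ ws → g (ws ++ u ∷ []))) ∎
  where
  inner : Word → Word → ℤ
  inner v u = ∑upTo k (λ ws → g (v ∷ ws ++ u ∷ []))

∑upTo-cons₀ : ∀ k g → g [] ≡ + 0 → ∑upTo (suc k) g ≡ ∑word (λ v → ∑upTo k (λ ws → g (v ∷ ws)))
∑upTo-cons₀ k g g[]≡0 = trans (∑upTo-cons k g) (trans (cong (_+ ∑word (λ v → ∑upTo k (λ ws → g (v ∷ ws)))) g[]≡0) (ℤₚ.+-identityˡ _))

∑upTo-snoc₀ : ∀ k g → g [] ≡ + 0 → ∑upTo (suc k) g ≡ ∑word (λ v → ∑upTo k (λ ws → g (ws ++ v ∷ [])))
∑upTo-snoc₀ k g g[]≡0 = trans (∑upTo-snoc k g) (trans (cong (_+ ∑word (λ v → ∑upTo k (λ ws → g (ws ++ v ∷ [])))) g[]≡0) (ℤₚ.+-identityˡ _))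

Supported : ℕ → (List Word → ℤ) → Set
Supported m g = ∀ ws → m < length ws → g ws ≡ + 0

∑upTo-step : ∀ k g → Supported k g → ∑upTo (suc k) g ≡ ∑upTo k g
∑upTo-step zero    g supp =
  trans (∑upTo-cons 0 g) (cong (_+_ (g [])) (∑-zero allWords (λ v → cong (_+ + 0) (supp (v ∷ []) (s≤s z≤n)))))
∑upTo-step (suc k) g supp = begin
    ∑upTo (suc (suc k)) g
  ≡⟨ ∑upTo-cons (suc k) g ⟩
    g [] + ∑word (λ v → ∑upTo (suc k) (λ ws → g (v ∷ ws)))
  ≡⟨ cong (_+_ (g [])) (∑-cong allWords (λ v → ∑upTo-step k _ (λ ws k<|ws| → supp (v ∷ ws) (s≤s k<|ws|)))) ⟩
    g [] + ∑word (λ v → ∑upTo k (λ ws → g (v ∷ ws)))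
  ≡⟨ sym (∑upTo-cons k g) ⟩
    ∑upTo (suc k) g ∎

∑upTo-stable : ∀ d m g → Supported m g → ∑upTo (d ℕ.+ m) g ≡ ∑upTo m g
∑upTo-stable zero    m g supp = refl
∑upTo-stable (suc d) m g supp =
  trans (∑upTo-step (d ℕ.+ m) g (λ ws lt → supp ws (ℕₚ.≤-<-trans (ℕₚ.m≤n+m m d) lt)))
        (∑upTo-stable d m g supp)

==L-sound : ∀ a b → (a ==L b) ≡ true → a ≡ b
==L-sound A A _ = refl
==L-sound B B _ = refl
==L-sound X X _ = refl
==L-sound A B ()
==L-sound A X ()
==L-sound B A ()
==L-sound B X ()
==L-sound X A ()
==L-sound X B ()

==L-refl : ∀ a → (a ==L a) ≡ true
==L-refl A = refl
==L-refl B = refl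
==L-refl X = refl

==S-sound : ∀ u v → (u ==S v) ≡ true → u ≡ v
==S-sound []      []      _  = refl
==S-sound (a ∷ u) (b ∷ v) eq with a ==L b in a≟b | u ==S v in u≟v
... | true | true = cong₂ _∷_ (==L-sound a b a≟b) (==S-sound u v u≟v)
==S-sound []      (_ ∷ _) ()
==S-sound (_ ∷ _) []      ()

==S-complete : ∀ {u v} → u ≡ v → (u ==S v) ≡ true
==S-complete {[]}    refl = refl
==S-complete {a ∷ u} refl = cong₂ _∧_ (==L-refl a) (==S-complete {u} refl)

==S-false : ∀ u v → u ≢ v → (u ==S v) ≡ false
==S-false u v u≢v with u ==S v in u≟v
... | true  = ⊥-elim (u≢v (==S-sound u v u≟v))
... | false = refl

==S-cong : ∀ u v u′ v′ → (u ≡ v → u′ ≡ v′) → (u′ ≡ v′ → u ≡ v) → (u ==S v) ≡ (u′ ==S v′)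
==S-cong u v u′ v′ to from with u ==S v in u≟v | u′ ==S v′ in u′≟v′
... | true  | true  = refl
... | false | false = refl
... | true  | false = case trans (sym (==S-complete (to (==S-sound u v u≟v)))) u′≟v′ of λ ()
... | false | true  = case trans (sym (==S-complete (from (==S-sound u′ v′ u′≟v′)))) u≟v of λ ()

module _ {S : Set} where

  ++-split : (p r : List S) {q s : List S} → length p ≡ length r → p ++ q ≡ r ++ s → p ≡ r × q ≡ s
  ++-split []      []      _   eq = refl , eq
  ++-split (x ∷ p) (y ∷ r) |p| eq =
    let x≡y , eq′ = ∷-injective eq
        p≡r , q≡s = ++-split p r (ℕₚ.suc-injective |p|) eq′
    in cong₂ _∷_ x≡y p≡r , q≡s

  ++-split-suffix : (p r : List S) {q s : List S} → length q ≡ length s → p ++ q ≡ r ++ s → p ≡ r × q ≡ s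
  ++-split-suffix p r {q} {s} |q| eq = ++-split p r (ℕₚ.+-cancelʳ-≡ (length q) _ _ lengths) eq
    where
    lengths : length p ℕ.+ length q ≡ length r ℕ.+ length q
    lengths = begin
      length p ℕ.+ length q  ≡⟨ sym (length-++ p) ⟩
      length (p ++ q)        ≡⟨ cong length eq ⟩
      length (r ++ s)        ≡⟨ length-++ r ⟩
      length r ℕ.+ length s  ≡⟨ cong (length r ℕ.+_) (sym |q|) ⟩
      length r ℕ.+ length q  ∎

length-rotR : ∀ j U → length (rotR j U) ≡ length U
length-rotR j U = trans (length-++-comm (drop m U) (take m U)) (cong length (take++drop≡id m U))
  where m = length U ∸ j

rotR-split : ∀ j a V → j ≤ length V →
  Σ (List Letter) λ R → Σ (List Letter) λ P → rotR j (a ∷ V) ≡ R ++ a ∷ P × P ++ R ≡ V × length R ≡ j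
rotR-split j a V j≤|V| = drop k V , take k V , rotation , take++drop≡id k V , |R|≡j
  where
  k = length V ∸ j
  rotation : rotR j (a ∷ V) ≡ drop k V ++ a ∷ take k V
  rotation = cong (λ m → drop m (a ∷ V) ++ take m (a ∷ V)) (ℕₚ.+-∸-assoc 1 j≤|V|)
  |R|≡j : length (drop k V) ≡ j
  |R|≡j = trans (length-drop k V) (ℕₚ.m∸[m∸n]≡n j≤|V|)

rotR-zero : ∀ a V → rotR 0 (a ∷ V) ≡ a ∷ V
rotR-zero a V with rotR-split 0 a V z≤n
... | [] , P , rotation , P++[]≡V , _ = trans rotation (cong (a ∷_) (trans (sym (++-identityʳ P)) P++[]≡V))
... | _ ∷ _ , _ , _ , _ , ()

rotR-one : ∀ a b c V → Σ Letter λ r → Σ (List Letter) λ P → rotR 1 (a ∷ b ∷ c ∷ V) ≡ r ∷ a ∷ b ∷ P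
rotR-one a b c V =
  let r , last≡ = last-letter c V
  in r , take (length V) (c ∷ V) , cong (_++ a ∷ b ∷ take (length V) (c ∷ V)) last≡
  where
  last-letter : ∀ c V → Σ Letter λ r → drop (length V) (c ∷ V) ≡ r ∷ []
  last-letter c []      = c , refl
  last-letter c (d ∷ V) = last-letter d V

rotR-match : ∀ j a V s S → length s ≡ suc j → j ≤ length V →
  ((s ++ S) ==S rotR j (a ∷ V)) ≡ ((S ++ s) ==S (V ++ a ∷ []))
rotR-match j a V s S |s| j≤|V| with rotR-split j a V j≤|V|
... | R , P , rotation , refl , |R| =
  trans (cong ((s ++ S) ==S_) rotation) (==S-cong (s ++ S) (R ++ a ∷ P) (S ++ s) ((P ++ R) ++ a ∷ []) to from)
  where
  |s|≡|Ra| : length s ≡ length (R ++ a ∷ [])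
  |s|≡|Ra| = trans |s| (sym (trans (length-++-comm R (a ∷ [])) (cong suc |R|)))
  to : s ++ S ≡ R ++ a ∷ P → S ++ s ≡ (P ++ R) ++ a ∷ []
  to eq = let s≡Ra , S≡P = ++-split s (R ++ a ∷ []) |s|≡|Ra| (trans eq (sym (++-assoc R (a ∷ []) P)))
          in trans (cong₂ _++_ S≡P s≡Ra) (sym (++-assoc P R (a ∷ [])))
  from : S ++ s ≡ (P ++ R) ++ a ∷ [] → s ++ S ≡ R ++ a ∷ P
  from eq = let S≡P , s≡Ra = ++-split-suffix S P |s|≡|Ra| (trans eq (++-assoc P R (a ∷ [])))
            in trans (cong₂ _++_ s≡Ra S≡P) (++-assoc R (a ∷ []) P)

spell-length : ∀ v → 1 ≤ length (spell v) × length (spell v) ≤ 3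
spell-length wX   = s≤s z≤n , s≤s z≤n
spell-length wXA  = s≤s z≤n , s≤s (s≤s z≤n)
spell-length wXAA = s≤s z≤n , s≤s (s≤s (s≤s z≤n))
spell-length wAXA = s≤s z≤n , s≤s (s≤s (s≤s z≤n))
spell-length wAAA = s≤s z≤n , s≤s (s≤s (s≤s z≤n))
spell-length wBA  = s≤s z≤n , s≤s (s≤s z≤n)
spell-length wABA = s≤s z≤n , s≤s (s≤s (s≤s z≤n))
spell-length wXXA = s≤s z≤n , s≤s (s≤s (s≤s z≤n))

length-spellAll : ∀ ws → length ws ≤ length (spellAll ws)
length-spellAll []       = z≤n
length-spellAll (v ∷ ws) =
  ℕₚ.≤-trans (ℕₚ.+-mono-≤ (proj₁ (spell-length v)) (length-spellAll ws)) (ℕₚ.≤-reflexive (sym (length-++ (spell v))))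

spellAll-snoc : ∀ ws v → spellAll (ws ++ v ∷ []) ≡ spellAll ws ++ spell v
spellAll-snoc []       v = ++-identityʳ (spell v)
spellAll-snoc (u ∷ ws) v = trans (cong (spell u ++_) (spellAll-snoc ws v)) (sym (++-assoc (spell u) (spellAll ws) (spell v)))

foldr-rotate : ∀ {I C : Set} (f : I → C → C) (e : C) → (∀ x y c → f x (f y c) ≡ f y (f x c)) →
  ∀ xs v → foldr f e (xs ++ v ∷ []) ≡ foldr f e (v ∷ xs)
foldr-rotate f e comm []       v = refl
foldr-rotate f e comm (x ∷ xs) v = trans (cong (f x) (foldr-rotate f e comm xs v)) (comm x v _)

lastAllows : List Word → Word → Bool
lastAllows []       v = true
lastAllows (u ∷ us) v = allowed (lastW u us) v

validLin-snoc : ∀ ws v → validLin (ws ++ v ∷ []) ≡ validLin ws ∧ lastAllows ws v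
validLin-snoc []            v = refl
validLin-snoc (u ∷ [])      v = ∧-identityʳ (allowed u v)
validLin-snoc (u ∷ u′ ∷ us) v = trans (cong (allowed u u′ ∧_) (validLin-snoc (u′ ∷ us) v)) (sym (∧-assoc (allowed u u′) _ _))

-- A word that may be followed by every word (all words but X).
Unrestricted : Word → Set
Unrestricted v = ∀ u → allowed v u ≡ true

validLin-cons : ∀ v → Unrestricted v → ∀ ws → validLin (v ∷ ws) ≡ validLin ws
validLin-cons v free []       = refl
validLin-cons v free (u ∷ ws) = cong (_∧ validLin (u ∷ ws)) (free u)

wrapOK-cons : ∀ v → Unrestricted v → ∀ ws → wrapOK (v ∷ ws) ≡ lastAllows ws v
wrapOK-cons v free []       = free v
wrapOK-cons v free (u ∷ ws) = refl

-- Only XA and BA are ever forbidden, so AXA may follow every word.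
allowed-AXA : ∀ u → allowed u wAXA ≡ true
allowed-AXA wX   = refl
allowed-AXA wXA  = refl
allowed-AXA wXAA = refl
allowed-AXA wAXA = refl
allowed-AXA wAAA = refl
allowed-AXA wBA  = refl
allowed-AXA wABA = refl
allowed-AXA wXXA = refl

isParsing : List Letter → List Word → Bool
isParsing R ws = (spellAll ws ==S R) ∧ validLin ws

wrapsAt : ℕ → List Word → Bool
wrapsAt j ws = (j <ᵇ firstLen ws) ∧ wrapOK ws

contribution : ℕ → List Word → ℤ
contribution w ws = when (weightP ws ≡ᵇ w) (coefP ws)

lockTerm : List Letter → ℕ → List Word → ℤ
lockTerm T w ws = when (isParsing T ws) (contribution w ws)

cycTerm : List Letter → ℕ → ℕ → List Word → ℤ
cycTerm R j w ws = when (isParsing R ws) (when (wrapsAt j ws) (contribution w ws))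

∑-lockedParsings : ∀ R f → ∑ (lockedParsings R) f ≡ ∑upTo (length R) (λ ws → when (isParsing R ws) (f ws))
∑-lockedParsings R f = ∑-filter (listsUpTo (length R)) (isParsing R) f

locked-expand : ∀ T w → locked∣ T ∣ w ≡ ∑upTo (length T) (lockTerm T w)
locked-expand T w = trans (∑-filter (lockedParsings T) (λ ws → weightP ws ≡ᵇ w) coefP) (∑-lockedParsings T _)

cyclic-expand : ∀ U w →
  cyclic∣ U ∣ w ≡ ∑ (applyUpTo (λ j → j) (length U)) (λ j → ∑upTo (length U) (cycTerm (rotR j U) j w))
cyclic-expand U w = begin
    cyclic∣ U ∣ w
  ≡⟨ ∑-filter (concatMap at offsets) (λ p → weightP (proj₂ p) ≡ᵇ w) (λ p → coefP (proj₂ p)) ⟩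
    ∑ (concatMap at offsets) (λ p → contribution w (proj₂ p))
  ≡⟨ ∑-concatMap offsets at _ ⟩
    ∑ offsets (λ j → ∑ (at j) (λ p → contribution w (proj₂ p)))
  ≡⟨ ∑-cong offsets offset-j ⟩
    ∑ offsets (λ j → ∑upTo (length U) (cycTerm (rotR j U) j w)) ∎
  where
  offsets : List ℕ
  offsets = applyUpTo (λ j → j) (length U)
  at : ℕ → List (ℕ × List Word)
  at j = map (j ,_) (filterᵇ (wrapsAt j) (lockedParsings (rotR j U)))
  offset-j : ∀ j → ∑ (at j) (λ p → contribution w (proj₂ p)) ≡ ∑upTo (length U) (cycTerm (rotR j U) j w)
  offset-j j = begin
      ∑ (at j) (λ p → contribution w (proj₂ p))
    ≡⟨ ∑-map (filterᵇ (wrapsAt j) (lockedParsings (rotR j U))) (j ,_) (λ p → contribution w (proj₂ p)) ⟩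
      ∑ (filterᵇ (wrapsAt j) (lockedParsings (rotR j U))) (contribution w)
    ≡⟨ ∑-filter (lockedParsings (rotR j U)) (wrapsAt j) (contribution w) ⟩
      ∑ (lockedParsings (rotR j U)) (λ ws → when (wrapsAt j ws) (contribution w ws))
    ≡⟨ ∑-lockedParsings (rotR j U) _ ⟩
      ∑upTo (length (rotR j U)) (cycTerm (rotR j U) j w)
    ≡⟨ cong (λ n → ∑upTo n (cycTerm (rotR j U) j w)) (length-rotR j U) ⟩
      ∑upTo (length U) (cycTerm (rotR j U) j w) ∎

lockTerm-supported : ∀ T w → Supported (length T) (lockTerm T w)
lockTerm-supported T w ws |T|<|ws| with spellAll ws ==S T in spelt
... | false = refl
... | true  = ⊥-elim (ℕₚ.<⇒≱ |T|<|ws|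
                (ℕₚ.≤-trans (length-spellAll ws) (ℕₚ.≤-reflexive (cong length (==S-sound (spellAll ws) T spelt)))))

≤⇒≮ᵇ : ∀ {m n} → n ≤ m → (m <ᵇ n) ≡ false
≤⇒≮ᵇ z≤n       = refl
≤⇒≮ᵇ (s≤s n≤m) = ≤⇒≮ᵇ n≤m

<ᵇ-suc : ∀ j → (j <ᵇ suc j) ≡ true
<ᵇ-suc zero    = refl
<ᵇ-suc (suc j) = <ᵇ-suc j

offset-exceeds : ∀ R j w v ws → length (spell v) ≤ j → cycTerm R j w (v ∷ ws) ≡ + 0
offset-exceeds R j w v ws |v|≤j =
  trans (cong (λ b → when (isParsing R (v ∷ ws)) (when (b ∧ wrapOK (v ∷ ws)) (contribution w (v ∷ ws)))) (≤⇒≮ᵇ |v|≤j))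
        (when-0 _)

-- No word has more than three letters, so offsets ≥ 3 contribute nothing.
cycTerm-far : ∀ R k w ws → cycTerm R (3 ℕ.+ k) w ws ≡ + 0
cycTerm-far R k w []       = when-0 _
cycTerm-far R k w (v ∷ ws) = offset-exceeds R (3 ℕ.+ k) w v ws (ℕₚ.≤-trans (proj₂ (spell-length v)) (ℕₚ.m≤m+n 3 k))

rotation-term : ∀ j a V w v ws → length (spell v) ≡ suc j → j ≤ length V → Unrestricted v →
  cycTerm (rotR j (a ∷ V)) j w (v ∷ ws) ≡ lockTerm (V ++ a ∷ []) w (ws ++ v ∷ [])
rotation-term j a V w v ws |v| j≤|V| free = begin
    when (((s ++ S) ==S rotR j (a ∷ V)) ∧ validLin (v ∷ ws))
         (when ((j <ᵇ length s) ∧ wrapOK (v ∷ ws)) (contribution w (v ∷ ws)))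
  ≡⟨ cong₂ (λ m l → when (m ∧ l) (when ((j <ᵇ length s) ∧ wrapOK (v ∷ ws)) (contribution w (v ∷ ws))))
           (rotR-match j a V s S |v| j≤|V|) (validLin-cons v free ws) ⟩
    when (((S ++ s) ==S T) ∧ validLin ws) (when ((j <ᵇ length s) ∧ wrapOK (v ∷ ws)) (contribution w (v ∷ ws)))
  ≡⟨ cong₂ (λ b c → when (((S ++ s) ==S T) ∧ validLin ws) (when b c))
           (cong₂ _∧_ (trans (cong (j <ᵇ_) |v|) (<ᵇ-suc j)) (wrapOK-cons v free ws)) contribution-rotate ⟩
    when (((S ++ s) ==S T) ∧ validLin ws) (when (lastAllows ws v) (contribution w (ws ++ v ∷ [])))
  ≡⟨ sym (when-∧ (((S ++ s) ==S T) ∧ validLin ws) (lastAllows ws v) _) ⟩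
    when ((((S ++ s) ==S T) ∧ validLin ws) ∧ lastAllows ws v) (contribution w (ws ++ v ∷ []))
  ≡⟨ cong (λ b → when b (contribution w (ws ++ v ∷ [])))
          (trans (∧-assoc ((S ++ s) ==S T) (validLin ws) (lastAllows ws v))
                 (cong₂ (λ m l → (m ==S T) ∧ l) (sym (spellAll-snoc ws v)) (sym (validLin-snoc ws v)))) ⟩
    lockTerm T w (ws ++ v ∷ []) ∎
  where
  s = spell v
  S = spellAll ws
  T = V ++ a ∷ []
  contribution-rotate : contribution w (v ∷ ws) ≡ contribution w (ws ++ v ∷ [])
  contribution-rotate =
    cong₂ (λ n c → when (n ≡ᵇ w) c)
      (sym (foldr-rotate (λ u n → weight u ℕ.+ n) 0
             (λ x y n → CommSemigroupProps.x∙yz≈y∙xz ℕₚ.+-commutativeSemigroup (weight x) (weight y) n) ws v))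
      (sym (foldr-rotate (λ u c → coef u * c) (+ 1)
             (λ x y c → CommSemigroupProps.x∙yz≈y∙xz ℤₚ.*-commutativeSemigroup (coef x) (coef y) c) ws v))

module _ (W : List Letter) where

  private
    U T : List Letter
    U = A ∷ X ∷ A ∷ W
    T = X ∷ A ∷ W ++ A ∷ []
    k = suc (suc (length W))

  -- Only AXA reads AXA… from the first letter of U.
  only-AXA-at-0 : ∀ w ws → ∑word (λ v → cycTerm U 0 w (v ∷ ws)) ≡ cycTerm U 0 w (wAXA ∷ ws)
  only-AXA-at-0 w ws =
    trans (ℤₚ.+-identityˡ _) (trans (ℤₚ.+-identityˡ _) (trans (ℤₚ.+-identityˡ _) (ℤₚ.+-identityʳ _)))

  -- Removing the leading AXA (coefficient 2, weight 1) leaves a parsing of [W].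
  AXA-removed : ∀ w ws → cycTerm U 0 (suc w) (wAXA ∷ ws) ≡ + 2 * lockTerm W w ws
  AXA-removed w ws = begin
      when ((spellAll ws ==S W) ∧ validLin (wAXA ∷ ws)) (when (wrapOK (wAXA ∷ ws)) (when (weightP ws ≡ᵇ w) (+ 2 * coefP ws)))
    ≡⟨ cong₂ (λ l b → when ((spellAll ws ==S W) ∧ l) (when b (when (weightP ws ≡ᵇ w) (+ 2 * coefP ws))))
             (validLin-cons wAXA (λ _ → refl) ws) (allowed-AXA (lastW wAXA ws)) ⟩
      when (isParsing W ws) (when (weightP ws ≡ᵇ w) (+ 2 * coefP ws))
    ≡⟨ cong (when (isParsing W ws)) (when-* (weightP ws ≡ᵇ w) (+ 2) (coefP ws)) ⟩
      when (isParsing W ws) (+ 2 * contribution w ws)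
    ≡⟨ when-* (isParsing W ws) (+ 2) (contribution w ws) ⟩
      + 2 * lockTerm W w ws ∎

  offset-0 : ∀ w → ∑upTo (length U) (cycTerm (rotR 0 U) 0 w) ≡ ((+ 2) ·t locked∣ W ∣) w
  offset-0 w = begin
      ∑upTo (suc k) (cycTerm (rotR 0 U) 0 w)
    ≡⟨ cong (λ R → ∑upTo (suc k) (cycTerm R 0 w)) (rotR-zero A (X ∷ A ∷ W)) ⟩
      ∑upTo (suc k) (cycTerm U 0 w)
    ≡⟨ ∑upTo-cons₀ k (cycTerm U 0 w) refl ⟩
      ∑word (λ v → ∑upTo k (λ ws → cycTerm U 0 w (v ∷ ws)))
    ≡⟨ ∑-swap allWords (listsUpTo k) (λ v ws → cycTerm U 0 w (v ∷ ws)) ⟩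
      ∑upTo k (λ ws → ∑word (λ v → cycTerm U 0 w (v ∷ ws)))
    ≡⟨ ∑-cong (listsUpTo k) (only-AXA-at-0 w) ⟩
      ∑upTo k (λ ws → cycTerm U 0 w (wAXA ∷ ws))
    ≡⟨ by-weight w ⟩
      ((+ 2) ·t locked∣ W ∣) w ∎
    where
    by-weight : ∀ w → ∑upTo k (λ ws → cycTerm U 0 w (wAXA ∷ ws)) ≡ ((+ 2) ·t locked∣ W ∣) w
    by-weight zero    = ∑-zero (listsUpTo k) (λ ws → trans (cong (when (isParsing U (wAXA ∷ ws))) (when-0 (wrapsAt 0 (wAXA ∷ ws)))) (when-0 (isParsing U (wAXA ∷ ws))))
    by-weight (suc w) = begin
        ∑upTo k (λ ws → cycTerm U 0 (suc w) (wAXA ∷ ws))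
      ≡⟨ ∑-cong (listsUpTo k) (AXA-removed w) ⟩
        ∑upTo k (λ ws → + 2 * lockTerm W w ws)
      ≡⟨ ∑-scale (listsUpTo k) (+ 2) (lockTerm W w) ⟩
        + 2 * ∑upTo (2 ℕ.+ length W) (lockTerm W w)
      ≡⟨ cong (+ 2 *_) (∑upTo-stable 2 (length W) (lockTerm W w) (lockTerm-supported W w)) ⟩
        + 2 * ∑upTo (length W) (lockTerm W w)
      ≡⟨ cong (+ 2 *_) (sym (locked-expand W w)) ⟩
        + 2 * locked∣ W ∣ w ∎

  private
    C₁ C₂ : ℕ → List Word → ℤ
    C₁ w = cycTerm (rotR 1 U) 1 w
    C₂ w = cycTerm (rotR 2 U) 2 w

  -- T ends in A, so no parsing of [T] ends with the word X.
  ending-in-X : ∀ w ws → C₁ w (wX ∷ ws) + C₂ w (wX ∷ ws) ≡ lockTerm T w (ws ++ wX ∷ [])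
  ending-in-X w ws =
    trans (cong₂ _+_ (when-0 (isParsing (rotR 1 U) (wX ∷ ws))) (when-0 (isParsing (rotR 2 U) (wX ∷ ws))))
          (sym (cong (λ b → when (b ∧ validLin (ws ++ wX ∷ [])) (contribution w (ws ++ wX ∷ []))) no-match))
    where
    no-match : (spellAll (ws ++ wX ∷ []) ==S T) ≡ false
    no-match = ==S-false _ T (λ eq → case proj₂ (∷ʳ-injective _ (X ∷ A ∷ W) (trans (sym (spellAll-snoc ws wX)) eq)) of λ ())

  -- A two-letter word sits at offset 1.
  two-letter : ∀ w v ws → length (spell v) ≡ 2 → Unrestricted v → C₁ w (v ∷ ws) + C₂ w (v ∷ ws) ≡ lockTerm T w (ws ++ v ∷ [])
  two-letter w v ws |v| free =
    trans (cong₂ _+_ (rotation-term 1 A (X ∷ A ∷ W) w v ws |v| (s≤s z≤n) free)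
                     (offset-exceeds (rotR 2 U) 2 w v ws (ℕₚ.≤-reflexive |v|)))
          (ℤₚ.+-identityʳ _)

  -- A three-letter word sits at offset 2: at offset 1 its final A would face the X of U.
  three-letter : ∀ w v ws {x y} → spell v ≡ x ∷ y ∷ A ∷ [] → Unrestricted v →
    C₁ w (v ∷ ws) + C₂ w (v ∷ ws) ≡ lockTerm T w (ws ++ v ∷ [])
  three-letter w v ws spelt free =
    trans (cong₂ _+_ offset-1-clash (rotation-term 2 A (X ∷ A ∷ W) w v ws (cong length spelt) (s≤s (s≤s z≤n)) free))
          (ℤₚ.+-identityˡ _)
    where
    offset-1-clash : C₁ w (v ∷ ws) ≡ + 0
    offset-1-clash with rotR-one A X A W
    ... | r , P , rotation =
      cong (λ b → when (b ∧ validLin (v ∷ ws)) (when (wrapsAt 1 (v ∷ ws)) (contribution w (v ∷ ws))))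
           (==S-false _ _ (λ eq → case trans (cong (_++ spellAll ws) (sym spelt)) (trans eq rotation) of λ ()))

  last-word-to-front : ∀ w v ws → C₁ w (v ∷ ws) + C₂ w (v ∷ ws) ≡ lockTerm T w (ws ++ v ∷ [])
  last-word-to-front w wX   ws = ending-in-X w ws
  last-word-to-front w wXA  ws = two-letter w wXA ws refl (λ _ → refl)
  last-word-to-front w wBA  ws = two-letter w wBA ws refl (λ _ → refl)
  last-word-to-front w wXAA ws = three-letter w wXAA ws refl (λ _ → refl)
  last-word-to-front w wAXA ws = three-letter w wAXA ws refl (λ _ → refl)
  last-word-to-front w wAAA ws = three-letter w wAAA ws refl (λ _ → refl)
  last-word-to-front w wABA ws = three-letter w wABA ws refl (λ _ → refl)
  last-word-to-front w wXXA ws = three-letter w wXXA ws refl (λ _ → refl)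

  offsets-1-2 : ∀ w → ∑upTo (length U) (C₁ w) + ∑upTo (length U) (C₂ w) ≡ locked∣ T ∣ w
  offsets-1-2 w = begin
      ∑upTo (suc k) (C₁ w) + ∑upTo (suc k) (C₂ w)
    ≡⟨ cong₂ _+_ (∑upTo-cons₀ k (C₁ w) (when-0 _)) (∑upTo-cons₀ k (C₂ w) (when-0 _)) ⟩
      ∑word (λ v → ∑upTo k (λ ws → C₁ w (v ∷ ws))) + ∑word (λ v → ∑upTo k (λ ws → C₂ w (v ∷ ws)))
    ≡⟨ sym (∑-+ allWords (λ v → ∑upTo k (λ ws → C₁ w (v ∷ ws))) (λ v → ∑upTo k (λ ws → C₂ w (v ∷ ws)))) ⟩
      ∑word (λ v → ∑upTo k (λ ws → C₁ w (v ∷ ws)) + ∑upTo k (λ ws → C₂ w (v ∷ ws)))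
    ≡⟨ ∑-cong allWords (λ v → sym (∑-+ (listsUpTo k) (λ ws → C₁ w (v ∷ ws)) (λ ws → C₂ w (v ∷ ws)))) ⟩
      ∑word (λ v → ∑upTo k (λ ws → C₁ w (v ∷ ws) + C₂ w (v ∷ ws)))
    ≡⟨ ∑-cong allWords (λ v → ∑-cong (listsUpTo k) (last-word-to-front w v)) ⟩
      ∑word (λ v → ∑upTo k (λ ws → lockTerm T w (ws ++ v ∷ [])))
    ≡⟨ sym (∑upTo-snoc₀ k (lockTerm T w) refl) ⟩
      ∑upTo (suc k) (lockTerm T w)
    ≡⟨ cong (λ n → ∑upTo (suc (suc n)) (lockTerm T w)) (sym (length-++-comm W (A ∷ []))) ⟩
      ∑upTo (length T) (lockTerm T w)
    ≡⟨ sym (locked-expand T w) ⟩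
      locked∣ T ∣ w ∎

lemma4p10 : (W : List Letter) →
    cyclic∣ A ∷ X ∷ A ∷ W ∣ ≈P (((+ 2) ·t locked∣ W ∣) +P locked∣ X ∷ A ∷ W ++ A ∷ [] ∣)
lemma4p10 W w = begin
    cyclic∣ U ∣ w
  ≡⟨ cyclic-expand U w ⟩
    C 0 + (C 1 + (C 2 + ∑ (applyUpTo (λ j → 3 ℕ.+ j) (length W)) C))
  ≡⟨ cong (λ r → C 0 + (C 1 + (C 2 + r)))
          (∑-applyUpTo-zero C (3 ℕ.+_) (length W) (λ j → ∑-zero (listsUpTo (length U)) (cycTerm-far (rotR (3 ℕ.+ j) U) j w))) ⟩
    C 0 + (C 1 + (C 2 + + 0))
  ≡⟨ cong (λ r → C 0 + (C 1 + r)) (ℤₚ.+-identityʳ (C 2)) ⟩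
    C 0 + (C 1 + C 2)
  ≡⟨ cong₂ _+_ (offset-0 W w) (offsets-1-2 W w) ⟩
    ((+ 2) ·t locked∣ W ∣) w + locked∣ X ∷ A ∷ W ++ A ∷ [] ∣ w ∎
  where
  U = A ∷ X ∷ A ∷ W
  C : ℕ → ℤ
  C j = ∑upTo (length U) (cycTerm (rotR j U) j w)
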